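{- Let $V$ be a finite set, $d$ a nonnegative integer, and $f:2^V\to\{0,1,\dots,d\}$ a posimodular function. If there exist a subset $X\subseteq V$ and an element $s\in V\setminus X$ with $f(X)\ge f(X\cup\{s\})$, then every subset $Y\subseteq V$ with $Y\cap X=\emptyset$ satisfies $f(Y)\ge f(Y\setminus\{s\})$.
   Context: A set function $f:2^V\to\mathbb{R}$ is posimodular if $f(X)+f(Y)\ge f(X\setminus Y)+f(Y\setminus X)$ for all $X,Y\subseteq V$. -}

module Defs where

open import Data.Nat using (ℕ; _+_; _≥_)
open import Data.Fin.Subset using (Subset; _─_)

Posimodular : {n : ℕ} → (Subset n → ℕ) → Set
Posimodular f = ∀ X Y → f X + f Y ≥ f (X ─ Y) + f (Y ─ X)

-- Put A = X ∪ {s}. Posimodularity on the pair (A, Y) exchanges the two differences: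
-- f(A) + f(Y) ≥ f(A \ Y) + f(Y \ A), so f(A \ Y) ≥ f(A) forces f(Y) ≥ f(Y \ A).
-- As Y is disjoint from X, Y \ A = Y - s, while A \ Y is X when s ∈ Y and A itself
-- otherwise; in both cases f(A \ Y) ≥ f(A) by hypothesis.
module Submission where

open import Defs
open import Data.Nat using (ℕ; _≤_; _≥_)
open import Data.Nat.Properties using (≤-trans; ≤-reflexive; +-monoˡ-≤; +-cancelˡ-≤)
open import Data.Fin using (Fin; zero; suc)
open import Data.Fin.Subset using (Subset; _∈_; _∉_; _∪_; _∩_; _─_; _-_; ⁅_⁆; ⊥; inside; outside)
open import Data.Fin.Subset.Properties using (_∈?_; ∩-comm; ∪-identityʳ; p─q─r≡p─q∪r)
open import Data.Vec using ([]; _∷_; here; there)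
open import Data.Vec.Properties using (∷-injectiveʳ)
open import Relation.Binary.PropositionalEquality using (_≡_; refl; cong; sym; trans; subst; module ≡-Reasoning)
open import Relation.Nullary using (yes; no; contradiction)

p∩q≡⊥⇒p─q≡p : ∀ {n} (p q : Subset n) → p ∩ q ≡ ⊥ → p ─ q ≡ p
p∩q≡⊥⇒p─q≡p []            []            _   = refl
p∩q≡⊥⇒p─q≡p (outside ∷ p) (outside ∷ q) eq = cong (outside ∷_) (p∩q≡⊥⇒p─q≡p p q (∷-injectiveʳ eq))
p∩q≡⊥⇒p─q≡p (outside ∷ p) (inside  ∷ q) eq = cong (outside ∷_) (p∩q≡⊥⇒p─q≡p p q (∷-injectiveʳ eq))
p∩q≡⊥⇒p─q≡p (inside  ∷ p) (outside ∷ q) eq = cong (inside ∷_)  (p∩q≡⊥⇒p─q≡p p q (∷-injectiveʳ eq))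
p∩q≡⊥⇒p─q≡p (inside  ∷ p) (inside  ∷ q) ()

─-distribʳ-∪ : ∀ {n} (p q r : Subset n) → (p ∪ q) ─ r ≡ (p ─ r) ∪ (q ─ r)
─-distribʳ-∪ []      []      []            = refl
─-distribʳ-∪ (x ∷ p) (y ∷ q) (outside ∷ r) = cong (_ ∷_) (─-distribʳ-∪ p q r)
─-distribʳ-∪ (x ∷ p) (y ∷ q) (inside  ∷ r) = cong (outside ∷_) (─-distribʳ-∪ p q r)

⊥─p≡⊥ : ∀ {n} (p : Subset n) → ⊥ ─ p ≡ ⊥
⊥─p≡⊥ []            = refl
⊥─p≡⊥ (outside ∷ p) = cong (outside ∷_) (⊥─p≡⊥ p)
⊥─p≡⊥ (inside  ∷ p) = cong (outside ∷_) (⊥─p≡⊥ p)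

x∈p⇒⁅x⁆─p≡⊥ : ∀ {n} {x : Fin n} {p : Subset n} → x ∈ p → ⁅ x ⁆ ─ p ≡ ⊥
x∈p⇒⁅x⁆─p≡⊥ {x = zero}  {inside  ∷ p} here      = cong (outside ∷_) (⊥─p≡⊥ p)
x∈p⇒⁅x⁆─p≡⊥ {x = suc x} {outside ∷ p} (there i) = cong (outside ∷_) (x∈p⇒⁅x⁆─p≡⊥ i)
x∈p⇒⁅x⁆─p≡⊥ {x = suc x} {inside  ∷ p} (there i) = cong (outside ∷_) (x∈p⇒⁅x⁆─p≡⊥ i)

x∉p⇒⁅x⁆─p≡⁅x⁆ : ∀ {n} {x : Fin n} {p : Subset n} → x ∉ p → ⁅ x ⁆ ─ p ≡ ⁅ x ⁆
x∉p⇒⁅x⁆─p≡⁅x⁆ {x = zero}  {inside  ∷ p} x∉p = contradiction here x∉p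
x∉p⇒⁅x⁆─p≡⁅x⁆ {x = zero}  {outside ∷ p} x∉p = cong (inside ∷_) (⊥─p≡⊥ p)
x∉p⇒⁅x⁆─p≡⁅x⁆ {x = suc x} {outside ∷ p} x∉p = cong (outside ∷_) (x∉p⇒⁅x⁆─p≡⁅x⁆ (λ i → x∉p (there i)))
x∉p⇒⁅x⁆─p≡⁅x⁆ {x = suc x} {inside  ∷ p} x∉p = cong (outside ∷_) (x∉p⇒⁅x⁆─p≡⁅x⁆ (λ i → x∉p (there i)))

posimodular-exchange : ∀ {n} {f : Subset n → ℕ} → Posimodular f →
                       ∀ A Y → f (A ─ Y) ≥ f A → f Y ≥ f (Y ─ A)
posimodular-exchange {f = f} posimodular A Y fA≤f[A─Y] =
  +-cancelˡ-≤ (f A) _ _ (≤-trans (+-monoˡ-≤ (f (Y ─ A)) fA≤f[A─Y]) (posimodular A Y))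

lemma6 : (n d : ℕ) (f : Subset n → ℕ) → (∀ Z → f Z ≤ d) → Posimodular f →
         (X : Subset n) (s : Fin n) → s ∉ X → f X ≥ f (X ∪ ⁅ s ⁆) →
         (Y : Subset n) → Y ∩ X ≡ ⊥ → f Y ≥ f (Y - s)
lemma6 n d f _ posimodular X s _ fA≤fX Y Y∩X≡⊥ =
  subst (λ Z → f Y ≥ f Z) Y─A≡Y-s (posimodular-exchange posimodular A Y fA≤f[A─Y])
  where
  open ≡-Reasoning

  A : Subset n
  A = X ∪ ⁅ s ⁆

  Y─A≡Y-s : Y ─ A ≡ Y - s
  Y─A≡Y-s = begin
    Y ─ (X ∪ ⁅ s ⁆)  ≡⟨ p─q─r≡p─q∪r Y X ⁅ s ⁆ ⟨
    Y ─ X ─ ⁅ s ⁆    ≡⟨ cong (_- s) (p∩q≡⊥⇒p─q≡p Y X Y∩X≡⊥) ⟩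
    Y - s            ∎

  A─Y≡X∪[⁅s⁆─Y] : A ─ Y ≡ X ∪ (⁅ s ⁆ ─ Y)
  A─Y≡X∪[⁅s⁆─Y] = begin
    (X ∪ ⁅ s ⁆) ─ Y        ≡⟨ ─-distribʳ-∪ X ⁅ s ⁆ Y ⟩
    (X ─ Y) ∪ (⁅ s ⁆ ─ Y)  ≡⟨ cong (_∪ (⁅ s ⁆ ─ Y)) (p∩q≡⊥⇒p─q≡p X Y (trans (∩-comm X Y) Y∩X≡⊥)) ⟩
    X ∪ (⁅ s ⁆ ─ Y)        ∎

  fA≤f[A─Y] : f (A ─ Y) ≥ f A
  fA≤f[A─Y] with s ∈? Y
  ... | yes s∈Y = subst (λ Z → f Z ≥ f A) (sym A─Y≡X) fA≤fX
    where
    A─Y≡X : A ─ Y ≡ X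
    A─Y≡X = trans A─Y≡X∪[⁅s⁆─Y] (trans (cong (X ∪_) (x∈p⇒⁅x⁆─p≡⊥ s∈Y)) (∪-identityʳ X))
  ... | no  s∉Y = ≤-reflexive (cong f (sym A─Y≡A))
    where
    A─Y≡A : A ─ Y ≡ A
    A─Y≡A = trans A─Y≡X∪[⁅s⁆─Y] (cong (X ∪_) (x∉p⇒⁅x⁆─p≡⁅x⁆ s∉Y))
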